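{- For all positive integers $n,k$ with $n\ge 2k+2$, one has $d_{n,k}^2\ge d_{n,k+1}\,d_{n,k-1}$.
   Context: For integers $n\ge0$, $k\ge0$, $d_{n,k}:=\sum_{i=2k}^{n}(n-i+1)\binom{n-k+1}{i-2k}$ (an empty sum being $0$). -}

module Defs where

open import Data.Nat using (ℕ; zero; suc; _+_; _*_; _∸_; _≤?_)
open import Data.Nat.Combinatorics using (_C_)
open import Relation.Nullary using (yes; no)

sumFrom : ℕ → ℕ → (ℕ → ℕ) → ℕ
sumFrom a zero    f = 0
sumFrom a (suc m) f = f a + sumFrom (suc a) m f

sumRange : ℕ → ℕ → (ℕ → ℕ) → ℕ
sumRange lo hi f with lo ≤? hi
... | yes _ = sumFrom lo (suc (hi ∸ lo)) f
... | no  _ = 0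

-- d_{n,k} = ∑_{i=2k}^{n} (n - i + 1) * C(n-k+1, i-2k)
-- (on the summation range i ≤ n and i ≥ 2k, so truncated subtraction is exact)
d : ℕ → ℕ → ℕ
d n k = sumRange (2 * k) n (λ i → (n ∸ i + 1) * ((n ∸ k + 1) C (i ∸ 2 * k)))

{-# OPTIONS --safe #-}
-- Reindexing the sum gives d n k = W (n+1-2k) (n+1-k) with W L t = Σ_{j<L} (L-j)·C(t,j),
-- so Pascal's rule turns into the recurrence d(n+2,k+1) = d(n+1,k+1) + d(n,k), and
-- d n k is positive exactly when 2k ≤ n.  For any such array, log-concavity of the rows
-- is proved by induction on n simultaneously with two inequalities comparing consecutive
-- rows (the ratios d(n+1,k)/d(n,k) increase and d(n+1,k+1)/d(n,k) decrease in k); the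
-- only base case is the first of these in column 0, checked from the closed forms
-- d(n,0) = (n+1)·2^n and d(m+2,1) = m·2^(m+1) + 1.
module Submission where

open import Defs
open import Data.Nat using (ℕ; zero; suc; _+_; _*_; _∸_; _^_; _≤_; _<_; z≤n; s≤s; z<s; _≤?_; >-nonZero)
open import Data.Nat.Properties
open import Data.Nat.Combinatorics using (_C_; nCk+nC[k+1]≡[n+1]C[k+1])
open import Data.Nat.Tactic.RingSolver using (solve-∀)
open import Data.Fin using (Fin; toℕ)
open import Data.Fin.Properties using (toℕ≤pred[n])
open import Algebra.Properties.Monoid.Sum +-0-monoid using (sum; sum-cong-≗; sum-replicate-zero)
open import Algebra.Properties.CommutativeMonoid.Sum +-0-commutativeMonoid using (∑-distrib-+)
open import Relation.Binary.PropositionalEquality using (_≡_; refl; sym; trans; cong; cong₂; subst; module ≡-Reasoning)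
open import Relation.Nullary using (yes; no; contradiction)
open import Data.Sum using (inj₁; inj₂)

n<2^n : ∀ n → n < 2 ^ n
n<2^n zero    = z<s
n<2^n (suc n) = +-mono-≤ (m^n>0 2 n) (≤-trans (n<2^n n) (m≤m+n (2 ^ n) 0))

n<2*k⇒2+n<2*[1+k] : ∀ {n k} → n < 2 * k → 2 + n < 2 * suc k
n<2*k⇒2+n<2*[1+k] {n} {k} n<2k = subst (2 + n <_) (sym (*-suc 2 k)) (s≤s (s≤s n<2k))

m≡0⇒m*n≤o : ∀ {m} n {o} → m ≡ 0 → m * n ≤ o
m≡0⇒m*n≤o n refl = z≤n

n≡0⇒m*n≤o : ∀ m {n o} → n ≡ 0 → m * n ≤ o
n≡0⇒m*n≤o m {o = o} refl = subst (_≤ o) (sym (*-zeroʳ m)) z≤n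

module RowLogConcavity
  (f        : ℕ → ℕ → ℕ)
  (f-step   : ∀ n k → f (2 + n) (suc k) ≡ f (suc n) (suc k) + f n k)
  (f-vanish : ∀ n k → n < 2 * k → f n k ≡ 0)
  (f-pos    : ∀ n k → 2 * k ≤ n → 0 < f n k)
  (f-base   : ∀ n → f (suc n) 0 * f n 1 ≤ f (suc n) 1 * f n 0)
  where

  open ≤-Reasoning

  rowRatio-mono      : ∀ n k → f (suc n) k * f n (suc k) ≤ f (suc n) (suc k) * f n k
  skewRatio-antimono : ∀ n k → f n k * f (suc n) (2 + k) ≤ f n (suc k) * f (suc n) (suc k)
  row-logConcave     : ∀ n k → f n (2 + k) * f n k ≤ f n (suc k) * f n (suc k)

  rowRatio-mono zero    k       = n≡0⇒m*n≤o (f 1 k) (f-vanish 0 (suc k) z<s)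
  rowRatio-mono (suc n) zero    = f-base (suc n)
  rowRatio-mono (suc n) (suc k) = begin
    f (2 + n) (suc k) * a  ≡⟨ cong (_* a) (f-step n k) ⟩
    (b + x) * a            ≡⟨ *-distribʳ-+ a b x ⟩
    b * a + x * a          ≤⟨ +-monoʳ-≤ (b * a) (skewRatio-antimono n k) ⟩
    b * a + y * b          ≡⟨ cong (_+ y * b) (*-comm b a) ⟩
    a * b + y * b          ≡⟨ *-distribʳ-+ b a y ⟨
    (a + y) * b            ≡⟨ cong (_* b) (f-step n (suc k)) ⟨
    f (2 + n) (2 + k) * b  ∎
    where
    a = f (suc n) (2 + k)
    b = f (suc n) (suc k)
    x = f n k
    y = f n (suc k)

  skewRatio-antimono zero    k = n≡0⇒m*n≤o (f 0 k) (f-vanish 1 (2 + k) (s≤s (s≤s z≤n)))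
  skewRatio-antimono (suc n) k = begin
    c * f (2 + n) (2 + k)  ≡⟨ cong (c *_) (f-step n (suc k)) ⟩
    c * (a + y)            ≡⟨ *-distribˡ-+ c a y ⟩
    c * a + c * y          ≤⟨ +-mono-≤ (subst (_≤ b * b) (*-comm a c) (row-logConcave (suc n) k))
                                     (rowRatio-mono n k) ⟩
    b * b + b * x          ≡⟨ *-distribˡ-+ b b x ⟨
    b * (b + x)            ≡⟨ cong (b *_) (f-step n k) ⟨
    b * f (2 + n) (suc k)  ∎
    where
    a = f (suc n) (2 + k)
    b = f (suc n) (suc k)
    c = f (suc n) k
    x = f n k
    y = f n (suc k)

  row-logConcave zero    k = m≡0⇒m*n≤o (f 0 k) (f-vanish 0 (2 + k) z<s)
  row-logConcave (suc n) k with ≤-<-connex (2 * suc k) n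
  ... | inj₂ n<2k+2 = m≡0⇒m*n≤o (f (suc n) k) (f-vanish (suc n) (2 + k) 1+n<2k+4)
    where
    1+n<2k+4 : suc n < 2 * (2 + k)
    1+n<2k+4 = <-trans (n<1+n (suc n)) (n<2*k⇒2+n<2*[1+k] {k = suc k} n<2k+2)
  ... | inj₁ 2k+2≤n = *-cancelʳ-≤ (a * c) (b * b) (x * y) {{>-nonZero (*-mono-< x>0 y>0)}} (begin
      a * c * (x * y)    ≡⟨ regroupˡ a c x y ⟩
      x * a * (c * y)    ≤⟨ *-mono-≤ (skewRatio-antimono n k) (rowRatio-mono n k) ⟩
      y * b * (b * x)    ≡⟨ regroupʳ b x y ⟩
      b * b * (x * y)    ∎)
    where
    a = f (suc n) (2 + k)
    b = f (suc n) (suc k)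
    c = f (suc n) k
    x = f n k
    y = f n (suc k)
    x>0 : 0 < x
    x>0 = f-pos n k (≤-trans (*-monoʳ-≤ 2 (n≤1+n k)) 2k+2≤n)
    y>0 : 0 < y
    y>0 = f-pos n (suc k) 2k+2≤n
    regroupˡ : ∀ a c x y → a * c * (x * y) ≡ x * a * (c * y)
    regroupˡ = solve-∀
    regroupʳ : ∀ b x y → y * b * (b * x) ≡ b * b * (x * y)
    regroupʳ = solve-∀

sumRange-nonempty : ∀ {lo hi} f → lo ≤ hi → sumRange lo hi f ≡ sumFrom lo (suc (hi ∸ lo)) f
sumRange-nonempty {lo} {hi} f lo≤hi with lo ≤? hi
... | yes _     = refl
... | no  lo≰hi = contradiction lo≤hi lo≰hi

sumRange-empty : ∀ {lo hi} f → hi < lo → sumRange lo hi f ≡ 0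
sumRange-empty {lo} {hi} f hi<lo with lo ≤? hi
... | yes lo≤hi = contradiction lo≤hi (<⇒≱ hi<lo)
... | no  _     = refl

sumFrom≡sum : ∀ a m f → sumFrom a m f ≡ sum λ (j : Fin m) → f (a + toℕ j)
sumFrom≡sum a zero    f = refl
sumFrom≡sum a (suc m) f = cong₂ _+_ (cong f (sym (+-identityʳ a)))
  (trans (sumFrom≡sum (suc a) m f) (sum-cong-≗ {m} λ j → cong f (sym (+-suc a (toℕ j)))))

weightedBinomialSum : ℕ → ℕ → ℕ
weightedBinomialSum L t = sum λ (j : Fin L) → (L ∸ toℕ j) * (t C toℕ j)

weightedBinomialSum-pos : ∀ L t → 0 < weightedBinomialSum (suc L) t
weightedBinomialSum-pos L t = ≤-trans (s≤s z≤n) (m≤m+n (suc L * 1) _)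

weightedBinomialSum-zeroʳ : ∀ L → weightedBinomialSum L 0 ≡ L
weightedBinomialSum-zeroʳ zero    = refl
weightedBinomialSum-zeroʳ (suc L) = begin
  suc L * 1 + sum (λ (j : Fin L) → (L ∸ toℕ j) * 0)
    ≡⟨ cong (suc L * 1 +_) (trans (sum-cong-≗ {L} λ j → *-zeroʳ (L ∸ toℕ j)) (sum-replicate-zero L)) ⟩
  suc L * 1 + 0                                     ≡⟨ +-identityʳ (suc L * 1) ⟩
  suc L * 1                                         ≡⟨ *-identityʳ (suc L) ⟩
  suc L                                             ∎
  where open ≡-Reasoning

weightedBinomialSum-pascal : ∀ L t →
  weightedBinomialSum (suc L) (suc t) ≡ weightedBinomialSum (suc L) t + weightedBinomialSum L t
weightedBinomialSum-pascal L t = begin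
  suc L * 1 + sum (λ (j : Fin L) → (L ∸ toℕ j) * (suc t C suc (toℕ j)))
    ≡⟨ cong (suc L * 1 +_) (sum-cong-≗ {L} λ j → pascal (L ∸ toℕ j) (toℕ j)) ⟩
  suc L * 1 + sum (λ (j : Fin L) → (L ∸ toℕ j) * (t C toℕ j) + (L ∸ toℕ j) * (t C suc (toℕ j)))
    ≡⟨ cong (suc L * 1 +_) (∑-distrib-+ {L} _ _) ⟩
  suc L * 1 + (weightedBinomialSum L t + shifted)
    ≡⟨ cong (suc L * 1 +_) (+-comm (weightedBinomialSum L t) shifted) ⟩
  suc L * 1 + (shifted + weightedBinomialSum L t)
    ≡⟨ +-assoc (suc L * 1) shifted (weightedBinomialSum L t) ⟨
  suc L * 1 + shifted + weightedBinomialSum L t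
    ∎
  where
  open ≡-Reasoning
  shifted = sum λ (j : Fin L) → (L ∸ toℕ j) * (t C suc (toℕ j))
  pascal : ∀ w j → w * (suc t C suc j) ≡ w * (t C j) + w * (t C suc j)
  pascal w j = trans (cong (w *_) (sym (nCk+nC[k+1]≡[n+1]C[k+1] t j))) (*-distribˡ-+ w _ _)

weightedBinomialSum-aboveDiagonal : ∀ t m → weightedBinomialSum (t + m) t * 2 ≡ (t + 2 * m) * 2 ^ t
weightedBinomialSum-aboveDiagonal zero    m = begin
  weightedBinomialSum m 0 * 2  ≡⟨ cong (_* 2) (weightedBinomialSum-zeroʳ m) ⟩
  m * 2                        ≡⟨ *-comm m 2 ⟩
  2 * m                        ≡⟨ *-identityʳ (2 * m) ⟨
  2 * m * 1                    ∎
  where open ≡-Reasoning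
weightedBinomialSum-aboveDiagonal (suc t) m = begin
  weightedBinomialSum (suc (t + m)) (suc t) * 2
    ≡⟨ cong (_* 2) (weightedBinomialSum-pascal (t + m) t) ⟩
  (weightedBinomialSum (suc (t + m)) t + weightedBinomialSum (t + m) t) * 2
    ≡⟨ *-distribʳ-+ 2 (weightedBinomialSum (suc (t + m)) t) (weightedBinomialSum (t + m) t) ⟩
  weightedBinomialSum (suc (t + m)) t * 2 + weightedBinomialSum (t + m) t * 2
    ≡⟨ cong (λ L → weightedBinomialSum L t * 2 + weightedBinomialSum (t + m) t * 2) (+-suc t m) ⟨
  weightedBinomialSum (t + suc m) t * 2 + weightedBinomialSum (t + m) t * 2
    ≡⟨ cong₂ _+_ (weightedBinomialSum-aboveDiagonal t (suc m)) (weightedBinomialSum-aboveDiagonal t m) ⟩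
  (t + 2 * suc m) * 2 ^ t + (t + 2 * m) * 2 ^ t
    ≡⟨ collect t m (2 ^ t) ⟩
  (suc t + 2 * m) * 2 ^ suc t
    ∎
  where
  open ≡-Reasoning
  collect : ∀ t m X → (t + 2 * suc m) * X + (t + 2 * m) * X ≡ (suc t + 2 * m) * (2 * X)
  collect = solve-∀

weightedBinomialSum-diagonal : ∀ n → weightedBinomialSum (suc n) (suc n) ≡ suc n * 2 ^ n
weightedBinomialSum-diagonal n = *-cancelʳ-≡ _ _ 2 (begin
  weightedBinomialSum (suc n) (suc n) * 2
    ≡⟨ cong (λ L → weightedBinomialSum L (suc n) * 2) (+-identityʳ (suc n)) ⟨
  weightedBinomialSum (suc n + 0) (suc n) * 2
    ≡⟨ weightedBinomialSum-aboveDiagonal (suc n) 0 ⟩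
  (suc n + 2 * 0) * 2 ^ suc n
    ≡⟨ halve n (2 ^ n) ⟩
  suc n * 2 ^ n * 2
    ∎)
  where
  open ≡-Reasoning
  halve : ∀ n X → (suc n + 2 * 0) * (2 * X) ≡ suc n * X * 2
  halve = solve-∀

m∸n+1≡1+m∸n : ∀ {m n} → n ≤ m → m ∸ n + 1 ≡ suc m ∸ n
m∸n+1≡1+m∸n n≤m = trans (+-comm _ 1) (sym (+-∸-assoc 1 n≤m))

d-vanish : ∀ n k → n < 2 * k → d n k ≡ 0
d-vanish n k n<2k = sumRange-empty _ n<2k

d≡weightedBinomialSum : ∀ n k → d n k ≡ weightedBinomialSum (suc n ∸ 2 * k) (suc n ∸ k)
d≡weightedBinomialSum n k with ≤-<-connex (2 * k) n
... | inj₂ n<2k = trans (d-vanish n k n<2k)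
  (cong (λ L → weightedBinomialSum L (suc n ∸ k)) (sym (m≤n⇒m∸n≡0 n<2k)))
... | inj₁ 2k≤n = begin
  d n k                                                    ≡⟨ sumRange-nonempty {2 * k} {n} term 2k≤n ⟩
  sumFrom (2 * k) (suc (n ∸ 2 * k)) term                   ≡⟨ sumFrom≡sum (2 * k) (suc (n ∸ 2 * k)) term ⟩
  sum (λ (j : Fin (suc (n ∸ 2 * k))) → term (2 * k + toℕ j))
                                                           ≡⟨ sum-cong-≗ reindex ⟩
  weightedBinomialSum (suc (n ∸ 2 * k)) (suc n ∸ k)        ≡⟨ cong (λ L → weightedBinomialSum L (suc n ∸ k)) (+-∸-assoc 1 2k≤n) ⟨
  weightedBinomialSum (suc n ∸ 2 * k) (suc n ∸ k)          ∎
  where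
  open ≡-Reasoning
  term : ℕ → ℕ
  term i = (n ∸ i + 1) * ((n ∸ k + 1) C (i ∸ 2 * k))
  reindex : (j : Fin (suc (n ∸ 2 * k))) →
    term (2 * k + toℕ j) ≡ (suc (n ∸ 2 * k) ∸ toℕ j) * ((suc n ∸ k) C toℕ j)
  reindex j = cong₂ _*_
    (trans (cong (_+ 1) (sym (∸-+-assoc n (2 * k) (toℕ j)))) (m∸n+1≡1+m∸n (toℕ≤pred[n] j)))
    (cong₂ _C_ (m∸n+1≡1+m∸n (≤-trans (m≤m+n k _) 2k≤n)) (m+n∸m≡n (2 * k) (toℕ j)))

d-pos : ∀ n k → 2 * k ≤ n → 0 < d n k
d-pos n k 2k≤n = begin-strict
  0                                                    <⟨ weightedBinomialSum-pos (n ∸ 2 * k) (suc n ∸ k) ⟩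
  weightedBinomialSum (suc (n ∸ 2 * k)) (suc n ∸ k)    ≡⟨ cong (λ L → weightedBinomialSum L (suc n ∸ k)) (+-∸-assoc 1 2k≤n) ⟨
  weightedBinomialSum (suc n ∸ 2 * k) (suc n ∸ k)      ≡⟨ d≡weightedBinomialSum n k ⟨
  d n k                                                ∎
  where open ≤-Reasoning

d-step : ∀ n k → d (2 + n) (suc k) ≡ d (suc n) (suc k) + d n k
d-step n k with ≤-<-connex (2 * k) n
... | inj₂ n<2k = begin
  d (2 + n) (suc k)          ≡⟨ d-vanish (2 + n) (suc k) (n<2*k⇒2+n<2*[1+k] n<2k) ⟩
  0                          ≡⟨ cong₂ _+_ (d-vanish (suc n) (suc k) 1+n<2k+2) (d-vanish n k n<2k) ⟨
  d (suc n) (suc k) + d n k  ∎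
  where
  open ≡-Reasoning
  1+n<2k+2 : suc n < 2 * suc k
  1+n<2k+2 = <-trans (n<1+n (suc n)) (n<2*k⇒2+n<2*[1+k] n<2k)
... | inj₁ 2k≤n = begin
  d (2 + n) (suc k)                          ≡⟨ d[1+m,1+k]≡W (suc n) ⟩
  W (suc n ∸ 2 * k) (2 + n ∸ k)              ≡⟨ cong₂ W (+-∸-assoc 1 2k≤n) (+-∸-assoc 1 (m≤n⇒m≤1+n k≤n)) ⟩
  W (suc L) (suc t)                          ≡⟨ weightedBinomialSum-pascal L t ⟩
  W (suc L) t + W L t                        ≡⟨ +-comm (W (suc L) t) (W L t) ⟩
  W L t + W (suc L) t                        ≡⟨ cong (λ i → W L t + W i t) (+-∸-assoc 1 2k≤n) ⟨
  W L t + W (suc n ∸ 2 * k) t                ≡⟨ cong₂ _+_ (d[1+m,1+k]≡W n) (d≡weightedBinomialSum n k) ⟨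
  d (suc n) (suc k) + d n k                  ∎
  where
  open ≡-Reasoning
  W = weightedBinomialSum
  L = n ∸ 2 * k
  t = suc n ∸ k
  k≤n : k ≤ n
  k≤n = ≤-trans (m≤m+n k _) 2k≤n
  d[1+m,1+k]≡W : ∀ m → d (suc m) (suc k) ≡ W (m ∸ 2 * k) (suc m ∸ k)
  d[1+m,1+k]≡W m = trans (d≡weightedBinomialSum (suc m) (suc k))
    (cong (λ i → W (2 + m ∸ i) (suc m ∸ k)) (*-suc 2 k))

d-column0 : ∀ n → d n 0 ≡ suc n * 2 ^ n
d-column0 n = trans (d≡weightedBinomialSum n 0) (weightedBinomialSum-diagonal n)

d-column1 : ∀ m → d (2 + m) 1 ≡ m * 2 ^ suc m + 1
d-column1 zero    = refl
d-column1 (suc m) = begin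
  d (3 + m) 1                                ≡⟨ d-step (suc m) 0 ⟩
  d (2 + m) 1 + d (suc m) 0                  ≡⟨ cong₂ _+_ (d-column1 m) (d-column0 (suc m)) ⟩
  m * 2 ^ suc m + 1 + (2 + m) * 2 ^ suc m    ≡⟨ collect m (2 ^ suc m) ⟩
  suc m * 2 ^ (2 + m) + 1                    ∎
  where
  open ≡-Reasoning
  collect : ∀ m X → m * X + 1 + (2 + m) * X ≡ suc m * (2 * X) + 1
  collect = solve-∀

d-base : ∀ n → d (suc n) 0 * d n 1 ≤ d (suc n) 1 * d n 0
d-base zero          = z≤n
d-base (suc zero)    = z≤n
d-base (suc (suc m)) = begin
  d (3 + m) 0 * d (2 + m) 1                           ≡⟨ cong₂ _*_ (d-column0 (3 + m)) (d-column1 m) ⟩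
  (4 + m) * 2 ^ (3 + m) * (m * 2 ^ suc m + 1)         ≡⟨ lhs≡ m (2 ^ m) ⟩
  common + 4 * (m + 5) * 2 ^ m                        ≤⟨ +-monoʳ-≤ common (*-monoˡ-≤ (2 ^ m) (*-monoʳ-≤ 4 m+5≤12*2^m)) ⟩
  common + 4 * (12 * 2 ^ m) * 2 ^ m                   ≡⟨ rhs≡ m (2 ^ m) ⟨
  (suc m * 2 ^ (2 + m) + 1) * ((3 + m) * 2 ^ (2 + m)) ≡⟨ cong₂ _*_ (d-column1 (suc m)) (d-column0 (2 + m)) ⟨
  d (3 + m) 1 * d (2 + m) 0                           ∎
  where
  open ≤-Reasoning
  common = 16 * m * (m + 4) * 2 ^ m * 2 ^ m + (4 * m + 12) * 2 ^ m
  lhs≡ : ∀ m Y → (4 + m) * (2 * (2 * (2 * Y))) * (m * (2 * Y) + 1)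
               ≡ 16 * m * (m + 4) * Y * Y + (4 * m + 12) * Y + 4 * (m + 5) * Y
  lhs≡ = solve-∀
  rhs≡ : ∀ m Y → (suc m * (2 * (2 * Y)) + 1) * ((3 + m) * (2 * (2 * Y)))
               ≡ 16 * m * (m + 4) * Y * Y + (4 * m + 12) * Y + 4 * (12 * Y) * Y
  rhs≡ = solve-∀
  m+5≤12*2^m : m + 5 ≤ 12 * 2 ^ m
  m+5≤12*2^m = begin
    m + 5                  ≤⟨ m≤m+n (m + 5) (11 * m + 7) ⟩
    m + 5 + (11 * m + 7)   ≡⟨ twelve m ⟩
    12 * suc m             ≤⟨ *-monoʳ-≤ 12 (n<2^n m) ⟩
    12 * 2 ^ m             ∎
    where
    twelve : ∀ m → m + 5 + (11 * m + 7) ≡ 12 * suc m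
    twelve = solve-∀

open RowLogConcavity d d-step d-vanish d-pos d-base using (row-logConcave)

lemma5p1 : (n k : ℕ) → 1 ≤ k → 2 * k + 2 ≤ n →
    d n (k + 1) * d n (k ∸ 1) ≤ d n k * d n k
lemma5p1 n (suc k) _ _ =
  subst (λ i → d n i * d n k ≤ d n (suc k) * d n (suc k)) (+-comm 1 (suc k)) (row-logConcave n k)
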